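{- Let $G=(X,Y,E)$ be a chain graph without isolated vertices, with a chain partition of length $k$. Then: (a) $\gamma_t(G)=2$; (b) $2\le \chi_{td}(G)\le 4$; (c) if $k\ge 2$ then $\chi_{td}(G)\ge 3$; (d) if $k\ge 3$ then $\chi_{td}(G)=4$.
   Context: A bipartite graph $G=(X,Y,E)$ (parts $X,Y$ independent) is a chain graph if the vertices of $X$ can be ordered $x_1,\dots,x_{n_1}$ with $N(x_1)\subseteq N(x_2)\subseteq\cdots\subseteq N(x_{n_1})$. Its chain partition is obtained as follows: partition $X$ into classes $X_1,\dots,X_k$ of vertices with equal neighbourhoods, indexed so that $N(X_1)\subsetneq N(X_2)\subsetneq\cdots\subsetneq N(X_k)$; set $Y_1=N(X_1)$ and $Y_i=N(X_i)\setminus\bigcup_{j<i}N(X_j)$ for $2\le i\le k$. Then for $x\in X_i$, $N(x)=\bigcup_{j\le i}Y_j$, and for $y\in Y_i$, $N(y)=\bigcup_{j\ge i}X_j$; $k$ is the length of the chain partition. A total dominating set of $G$ is a set $D$ such that every vertex has a neighbour in $D$; $\gamma_t(G)$ is its minimum size. A total dominator coloring (TD-coloring) is a proper vertex coloring in which every vertex is adjacent to all vertices of some color class; $\chi_{td}(G)$ is the minimum number of colors of a TD-coloring. -}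

module Defs where

open import Data.Nat using (ℕ; _≤_; _<_)
open import Data.Fin using (Fin) renaming (_≤_ to _≤ᶠ_; _<_ to _<ᶠ_)
open import Data.Bool using (Bool; true)
open import Data.Sum using (_⊎_; inj₁; inj₂)
open import Data.Product using (Σ; ∃; _×_)
open import Data.Empty using (⊥)
open import Data.List using (List; length)
open import Data.List.Membership.Propositional using (_∈_)
open import Data.List.Relation.Unary.Unique.Propositional using (Unique)
open import Relation.Binary.PropositionalEquality using (_≡_)
open import Relation.Nullary using (¬_)
open import Function.Definitions using (Bijective; Surjective)

record BipGraph : Set where
  field
    a : ℕ
    b : ℕ
    E : Fin a → Fin b → Bool

module _ (G : BipGraph) where
  open BipGraph G

  Vtx : Set
  Vtx = Fin a ⊎ Fin b

  Adj : Vtx → Vtx → Set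
  Adj (inj₁ x) (inj₁ _) = ⊥
  Adj (inj₁ x) (inj₂ y) = E x y ≡ true
  Adj (inj₂ y) (inj₁ x) = E x y ≡ true
  Adj (inj₂ _) (inj₂ _) = ⊥

  NSub : Fin a → Fin a → Set
  NSub x x' = ∀ y → E x y ≡ true → E x' y ≡ true

  NEq : Fin a → Fin a → Set
  NEq x x' = NSub x x' × NSub x' x

  NSSub : Fin a → Fin a → Set
  NSSub x x' = NSub x x' × ¬ NSub x' x

  IsChainGraph : Set
  IsChainGraph = Σ (Fin a → Fin a) λ σ → Bijective _≡_ _≡_ σ ×
                   (∀ i j → i ≤ᶠ j → NSub (σ i) (σ j))

  -- chain partition of length k: X is partitioned into classes X_1..X_k
  -- (class map cls, all classes nonempty) of vertices with equal
  -- neighbourhoods, with N(X_i) ⊊ N(X_j) whenever i < j.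
  -- (Vertices in different classes then automatically have distinct neighbourhoods.)
  HasChainPartitionOfLength : ℕ → Set
  HasChainPartitionOfLength k =
    Σ (Fin a → Fin k) λ cls → Surjective _≡_ _≡_ cls ×
      (∀ x x' → cls x ≡ cls x' → NEq x x') ×
      (∀ x x' → cls x <ᶠ cls x' → NSSub x x')

  NoIsolated : Set
  NoIsolated = ∀ v → ∃ λ u → Adj v u

  -- total dominating set, given as a duplicate-free list of vertices
  IsTotalDominating : List Vtx → Set
  IsTotalDominating D = ∀ v → ∃ λ u → u ∈ D × Adj v u

  IsGammaT : ℕ → Set
  IsGammaT n = (Σ (List Vtx) λ D → Unique D × IsTotalDominating D × length D ≡ n)
             × (∀ D → Unique D → IsTotalDominating D → n ≤ length D)

  IsProper : ∀ {m} → (Vtx → Fin m) → Set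
  IsProper c = ∀ u v → Adj u v → ¬ (c u ≡ c v)

  IsTDColoring : ∀ {m} → (Vtx → Fin m) → Set
  IsTDColoring {m} c = IsProper c ×
    (∀ v → Σ (Fin m) λ i → (∃ λ u → c u ≡ i) × (∀ u → c u ≡ i → Adj v u))

  TDColorable : ℕ → Set
  TDColorable m = Σ (Vtx → Fin m) IsTDColoring

  IsChiTD : ℕ → Set
  IsChiTD m = TDColorable m × (∀ m' → TDColorable m' → m ≤ m')

{-# OPTIONS --safe #-}
-- Any y⁺ ∈ N(X₁) is adjacent to all of X and any x⁺ ∈ X_k to all of Y, so {x⁺, y⁺} is a
-- total dominating set and x⁺, y⁺, X ∖ {x⁺}, Y ∖ {y⁺} are the classes of a TD-colouring.
-- For k = 1 the graph is complete bipartite, and for k = 2 the classes X₂, N(X₁) and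
-- X₁ ∪ (Y ∖ N(X₁)) form a TD-colouring.  The lower bounds are pigeonhole arguments: a
-- colour class dominated by v lies in N(v), so for an edge x₂y₂ with y₂ ∉ N(x₁) (one exists
-- when k ≥ 2) neither endpoint gets the colour dominated by x₁; when k ≥ 3, some y₃ ∉ N(x₂)
-- dominates a second such colour, distinct from the first as its class lies in X.
module Submission where

open import Defs
open import Data.Nat using (ℕ; _+_; _≤_; zero; suc; z≤n; s≤s)
open import Data.Nat.Properties using (≤-refl; ≰⇒>)
open import Data.Fin using (Fin; zero; suc; fromℕ; fromℕ<; inject≤; punchOut; _≟_; #_)
  renaming (_≤_ to _≤ᶠ_; _<_ to _<ᶠ_)
open import Data.Fin.Properties
  using (¬Fin0; ≤fromℕ; ≤∧≢⇒<; inject≤-injective; punchOut-injective; ¬∀⟶∃¬; all?)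
open import Data.Bool using (Bool; true; false)
import Data.Bool.Properties as Bool
open import Data.Sum using (_⊎_; inj₁; inj₂)
open import Data.Product using (Σ; ∃; _×_; _,_; proj₁; proj₂)
open import Data.Empty using (⊥-elim)
open import Data.List using (List; []; _∷_; length)
open import Data.List.Membership.Propositional using (_∈_)
open import Data.List.Relation.Unary.Any using (here; there)
open import Data.List.Relation.Unary.All using ([]; _∷_)
open import Data.List.Relation.Unary.AllPairs using ([]; _∷_)
open import Function using (_∘_)
open import Relation.Binary.PropositionalEquality using (_≡_; _≢_; refl; sym; trans; cong; subst; subst₂)
open import Relation.Nullary using (¬_; Dec; yes; no; contradiction)
open import Relation.Nullary.Decidable using (decidable-stable; _→-dec_)

Fin1-unique : (p q : Fin 1) → p ≡ q
Fin1-unique zero zero = refl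

Fin2-avoiding : {α p q : Fin 2} → α ≢ p → α ≢ q → p ≡ q
Fin2-avoiding α≢p α≢q = punchOut-injective α≢p α≢q (Fin1-unique _ _)

Fin3-avoiding : {α β p q : Fin 3} → α ≢ β → α ≢ p → α ≢ q → β ≢ p → β ≢ q → p ≡ q
Fin3-avoiding α≢β α≢p α≢q β≢p β≢q = punchOut-injective α≢p α≢q
  (Fin2-avoiding (β≢p ∘ punchOut-injective α≢β α≢p) (β≢q ∘ punchOut-injective α≢β α≢q))

∃-witness-of-⊈ : ∀ {n} (f g : Fin n → Bool) → ¬ (∀ y → f y ≡ true → g y ≡ true) →
                 ∃ λ y → f y ≡ true × g y ≢ true
∃-witness-of-⊈ f g f⊈g with ¬∀⟶∃¬ _ _ (λ y → f y Bool.≟ true →-dec g y Bool.≟ true) f⊈g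
... | y , ¬fy⇒gy = y , fy , λ gy → ¬fy⇒gy (λ _ → gy)
  where
  fy : f y ≡ true
  fy = decidable-stable (f y Bool.≟ true) (λ ¬fy → ¬fy⇒gy (λ fy → contradiction fy ¬fy))

distinct-members⇒2≤length : ∀ {A : Set} {u w : A} (D : List A) → u ∈ D → w ∈ D → u ≢ w →
                            2 ≤ length D
distinct-members⇒2≤length (_ ∷ []) (here refl) (here refl) u≢w = ⊥-elim (u≢w refl)
distinct-members⇒2≤length (_ ∷ []) (here _) (there ()) _
distinct-members⇒2≤length (_ ∷ []) (there ()) _ _
distinct-members⇒2≤length (_ ∷ _ ∷ _) _ _ _ = s≤s (s≤s z≤n)

module _ (G : BipGraph) where
  open BipGraph G

  Universalˣ : Fin a → Set
  Universalˣ x = ∀ y → E x y ≡ true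

  Universalʸ : Fin b → Set
  Universalʸ y = ∀ x → E x y ≡ true

  universalˣ? : ∀ x → Dec (Universalˣ x)
  universalˣ? x = all? (λ y → E x y Bool.≟ true)

  Adj-irreflexive : ∀ v → ¬ Adj G v v
  Adj-irreflexive (inj₁ _) ()
  Adj-irreflexive (inj₂ _) ()

  no-common-neighbour : ∀ {x y} u → Adj G (inj₁ x) u → ¬ Adj G (inj₂ y) u
  no-common-neighbour (inj₁ _) ()
  no-common-neighbour (inj₂ _) _ ()

  neighbourˣ : NoIsolated G → ∀ x → ∃ λ y → E x y ≡ true
  neighbourˣ noIso x with noIso (inj₁ x)
  ... | inj₂ y , xy = y , xy

  neighbourʸ : NoIsolated G → ∀ y → ∃ λ x → E x y ≡ true
  neighbourʸ noIso y with noIso (inj₂ y)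
  ... | inj₁ x , xy = x , xy

  2≤γt : ∀ {D} → Vtx G → IsTotalDominating G D → 2 ≤ length D
  2≤γt {D} v dominating with dominating v
  ... | u , u∈D , _ with dominating u
  ... | w , w∈D , uw = distinct-members⇒2≤length D u∈D w∈D (λ { refl → Adj-irreflexive u uw })

  universal-pair⇒γt≡2 : ∀ {x⁺ y⁺} → Universalˣ x⁺ → Universalʸ y⁺ → IsGammaT G 2
  universal-pair⇒γt≡2 {x⁺} {y⁺} x⁺-universal y⁺-universal =
    (inj₁ x⁺ ∷ inj₂ y⁺ ∷ [] , ((λ ()) ∷ []) ∷ [] ∷ [] , dominating , refl) ,
    λ _ _ → 2≤γt (inj₁ x⁺)
    where
    dominating : IsTotalDominating G (inj₁ x⁺ ∷ inj₂ y⁺ ∷ [])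
    dominating (inj₁ x) = inj₂ y⁺ , there (here refl) , y⁺-universal x
    dominating (inj₂ y) = inj₁ x⁺ , here refl , x⁺-universal y

  TDColorable-mono : ∀ {m n} → m ≤ n → TDColorable G m → TDColorable G n
  TDColorable-mono m≤n (c , proper , dominated) = c′ , proper′ , dominated′
    where
    c′ : Vtx G → Fin _
    c′ v = inject≤ (c v) m≤n
    inject-injective : ∀ {i j} → inject≤ i m≤n ≡ inject≤ j m≤n → i ≡ j
    inject-injective = inject≤-injective m≤n m≤n _ _
    proper′ : IsProper G c′
    proper′ u v uv = proper u v uv ∘ inject-injective
    dominated′ : ∀ v → Σ (Fin _) λ i → (∃ λ u → c′ u ≡ i) × (∀ u → c′ u ≡ i → Adj G v u)
    dominated′ v with dominated v
    ... | i , (u , cu≡i) , i⊆N[v] =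
      inject≤ i m≤n , (u , cong (λ j → inject≤ j m≤n) cu≡i) , λ w → i⊆N[v] w ∘ inject-injective

  TDColorable⇒IsChiTD : ∀ {m} → TDColorable G (suc m) → ¬ TDColorable G m → IsChiTD G (suc m)
  TDColorable⇒IsChiTD colorable ¬colorable =
    colorable , λ _ colorable′ → ≰⇒> (λ m′≤m → ¬colorable (TDColorable-mono m′≤m colorable′))

  class-avoids : ∀ {m} {c : Vtx G → Fin m} {i v u} →
                 (∀ w → c w ≡ i → Adj G v w) → ¬ Adj G v u → i ≢ c u
  class-avoids i⊆N[v] v≁u i≡cu = v≁u (i⊆N[v] _ (sym i≡cu))

  ¬TDColorable-1 : ∀ {x y} → E x y ≡ true → ¬ TDColorable G 1
  ¬TDColorable-1 {x} {y} xy (_ , proper , _) = proper (inj₁ x) (inj₂ y) xy (Fin1-unique _ _)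

  ¬TDColorable-2 : ∀ {x₁ x₂ y₂} → E x₂ y₂ ≡ true → E x₁ y₂ ≢ true → ¬ TDColorable G 2
  ¬TDColorable-2 {x₁} {x₂} {y₂} x₂y₂ x₁≁y₂ (c , proper , dominated) with dominated (inj₁ x₁)
  ... | α , _ , α⊆N[x₁] = proper (inj₁ x₂) (inj₂ y₂) x₂y₂
    (Fin2-avoiding (class-avoids α⊆N[x₁] λ ()) (class-avoids α⊆N[x₁] x₁≁y₂))

  ¬TDColorable-3 : ∀ {x₁ x₂ y₂ y₃} → E x₂ y₂ ≡ true → E x₁ y₂ ≢ true → E x₂ y₃ ≢ true →
                   ¬ TDColorable G 3
  ¬TDColorable-3 {x₁} {x₂} {y₂} {y₃} x₂y₂ x₁≁y₂ x₂≁y₃ (c , proper , dominated)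
    with dominated (inj₁ x₁) | dominated (inj₂ y₃)
  ... | α , (u , cu≡α) , α⊆N[x₁] | β , _ , β⊆N[y₃] = proper (inj₁ x₂) (inj₂ y₂) x₂y₂
    (Fin3-avoiding α≢β (class-avoids α⊆N[x₁] λ ()) (class-avoids α⊆N[x₁] x₁≁y₂)
                       (class-avoids β⊆N[y₃] x₂≁y₃) (class-avoids β⊆N[y₃] λ ()))
    where
    α≢β : α ≢ β
    α≢β α≡β = no-common-neighbour u (α⊆N[x₁] u cu≡α) (β⊆N[y₃] u (trans cu≡α α≡β))

  complete⇒TDColorable-2 : Fin a → Fin b → (∀ x y → E x y ≡ true) → TDColorable G 2
  complete⇒TDColorable-2 x₀ y₀ complete = side , proper , dominated
    where
    side : Vtx G → Fin 2
    side (inj₁ _) = # 0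
    side (inj₂ _) = # 1
    proper : IsProper G side
    proper (inj₁ _) (inj₂ _) _ ()
    proper (inj₂ _) (inj₁ _) _ ()
    dominated : ∀ v → Σ (Fin 2) λ i → (∃ λ u → side u ≡ i) × (∀ u → side u ≡ i → Adj G v u)
    dominated (inj₁ x) = # 1 , (inj₂ y₀ , refl) , λ { (inj₂ y) _ → complete x y }
    dominated (inj₂ y) = # 0 , (inj₁ x₀ , refl) , λ { (inj₁ x) _ → complete x y }

  minimal-or-universal⇒TDColorable-3 : ∀ {z y₀ x⁺} → E z y₀ ≡ true → Universalˣ x⁺ →
                  (∀ x → NSub G z x) → (∀ x → NSub G x z ⊎ Universalˣ x) → TDColorable G 3
  minimal-or-universal⇒TDColorable-3 {z} {y₀} {x⁺} zy₀ x⁺-universal N[z]⊆ ⊆N[z]-or-universal =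
    c , proper , dominated
    where
    c : Vtx G → Fin 3
    c (inj₁ x) with universalˣ? x
    ... | yes _ = # 0
    ... | no _ = # 2
    c (inj₂ y) with E z y
    ... | true = # 1
    ... | false = # 2
    properˣʸ : ∀ x y → E x y ≡ true → c (inj₁ x) ≢ c (inj₂ y)
    properˣʸ x y xy with universalˣ? x | E z y in zy
    ... | yes _ | true = λ ()
    ... | yes _ | false = λ ()
    ... | no _ | true = λ ()
    ... | no ¬universal | false with ⊆N[z]-or-universal x
    ... | inj₁ N[x]⊆N[z] = λ _ → contradiction (trans (sym zy) (N[x]⊆N[z] y xy)) λ ()
    ... | inj₂ universal = contradiction universal ¬universal
    proper : IsProper G c
    proper (inj₁ x) (inj₂ y) xy = properˣʸ x y xy
    proper (inj₂ y) (inj₁ x) xy = properˣʸ x y xy ∘ sym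
    c-x⁺ : c (inj₁ x⁺) ≡ # 0
    c-x⁺ with universalˣ? x⁺
    ... | yes _ = refl
    ... | no ¬universal = contradiction x⁺-universal ¬universal
    N[z]⊆class1 : ∀ {y} → E z y ≡ true → c (inj₂ y) ≡ # 1
    N[z]⊆class1 {y} zy with E z y
    N[z]⊆class1 {y} zy | true = refl
    N[z]⊆class1 {y} () | false
    class1⊆N[x] : ∀ x u → c u ≡ # 1 → Adj G (inj₁ x) u
    class1⊆N[x] x (inj₁ x′) _ with universalˣ? x′
    class1⊆N[x] x (inj₁ x′) () | yes _
    class1⊆N[x] x (inj₁ x′) () | no _
    class1⊆N[x] x (inj₂ y) _ with E z y in zy
    class1⊆N[x] x (inj₂ y) _  | true = N[z]⊆ x y zy
    class1⊆N[x] x (inj₂ y) () | false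
    class0⊆N[y] : ∀ y u → c u ≡ # 0 → Adj G (inj₂ y) u
    class0⊆N[y] y (inj₂ y′) _ with E z y′
    class0⊆N[y] y (inj₂ y′) () | true
    class0⊆N[y] y (inj₂ y′) () | false
    class0⊆N[y] y (inj₁ x) _ with universalˣ? x
    class0⊆N[y] y (inj₁ x) _  | yes universal = universal y
    class0⊆N[y] y (inj₁ x) () | no _
    dominated : ∀ v → Σ (Fin 3) λ i → (∃ λ u → c u ≡ i) × (∀ u → c u ≡ i → Adj G v u)
    dominated (inj₁ x) = # 1 , (inj₂ y₀ , N[z]⊆class1 zy₀) , class1⊆N[x] x
    dominated (inj₂ y) = # 0 , (inj₁ x⁺ , c-x⁺) , class0⊆N[y] y

  universal-pair⇒TDColorable-4 : ∀ {x⁺ y⁺} → Universalˣ x⁺ → Universalʸ y⁺ → TDColorable G 4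
  universal-pair⇒TDColorable-4 {x⁺} {y⁺} x⁺-universal y⁺-universal = c , proper , dominated
    where
    c : Vtx G → Fin 4
    c (inj₁ x) with x ≟ x⁺
    ... | yes _ = # 0
    ... | no _ = # 2
    c (inj₂ y) with y ≟ y⁺
    ... | yes _ = # 1
    ... | no _ = # 3
    properˣʸ : ∀ x y → c (inj₁ x) ≢ c (inj₂ y)
    properˣʸ x y with x ≟ x⁺ | y ≟ y⁺
    ... | yes _ | yes _ = λ ()
    ... | yes _ | no _ = λ ()
    ... | no _ | yes _ = λ ()
    ... | no _ | no _ = λ ()
    proper : IsProper G c
    proper (inj₁ x) (inj₂ y) _ = properˣʸ x y
    proper (inj₂ y) (inj₁ x) _ = properˣʸ x y ∘ sym
    class0≡x⁺ : ∀ u → c u ≡ # 0 → u ≡ inj₁ x⁺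
    class0≡x⁺ (inj₁ x) _ with x ≟ x⁺
    class0≡x⁺ (inj₁ x) _  | yes refl = refl
    class0≡x⁺ (inj₁ x) () | no _
    class0≡x⁺ (inj₂ y) _ with y ≟ y⁺
    class0≡x⁺ (inj₂ y) () | yes _
    class0≡x⁺ (inj₂ y) () | no _
    class1≡y⁺ : ∀ u → c u ≡ # 1 → u ≡ inj₂ y⁺
    class1≡y⁺ (inj₂ y) _ with y ≟ y⁺
    class1≡y⁺ (inj₂ y) _  | yes refl = refl
    class1≡y⁺ (inj₂ y) () | no _
    class1≡y⁺ (inj₁ x) _ with x ≟ x⁺
    class1≡y⁺ (inj₁ x) () | yes _
    class1≡y⁺ (inj₁ x) () | no _
    c-x⁺ : c (inj₁ x⁺) ≡ # 0
    c-x⁺ with x⁺ ≟ x⁺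
    ... | yes _ = refl
    ... | no x⁺≢x⁺ = contradiction refl x⁺≢x⁺
    c-y⁺ : c (inj₂ y⁺) ≡ # 1
    c-y⁺ with y⁺ ≟ y⁺
    ... | yes _ = refl
    ... | no y⁺≢y⁺ = contradiction refl y⁺≢y⁺
    dominated : ∀ v → Σ (Fin 4) λ i → (∃ λ u → c u ≡ i) × (∀ u → c u ≡ i → Adj G v u)
    dominated (inj₁ x) = # 1 , (inj₂ y⁺ , c-y⁺) , λ u cu≡1 →
      subst (Adj G (inj₁ x)) (sym (class1≡y⁺ u cu≡1)) (y⁺-universal x)
    dominated (inj₂ y) = # 0 , (inj₁ x⁺ , c-x⁺) , λ u cu≡0 →
      subst (Adj G (inj₂ y)) (sym (class0≡x⁺ u cu≡0)) (x⁺-universal y)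

module ChainPartition (G : BipGraph) (noIso : NoIsolated G) {n : ℕ}
                      (P : HasChainPartitionOfLength G (suc n)) where
  open BipGraph G

  cls : Fin a → Fin (suc n)
  cls = proj₁ P

  rep : Fin (suc n) → Fin a
  rep i = proj₁ (proj₁ (proj₂ P) i)

  cls-rep : ∀ i → cls (rep i) ≡ i
  cls-rep i = proj₂ (proj₁ (proj₂ P) i) refl

  same-class⇒NEq : ∀ x x′ → cls x ≡ cls x′ → NEq G x x′
  same-class⇒NEq = proj₁ (proj₂ (proj₂ P))

  smaller-class⇒NSSub : ∀ x x′ → cls x <ᶠ cls x′ → NSSub G x x′
  smaller-class⇒NSSub = proj₂ (proj₂ (proj₂ P))

  cls-≤⇒NSub : ∀ x x′ → cls x ≤ᶠ cls x′ → NSub G x x′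
  cls-≤⇒NSub x x′ cls≤ with cls x ≟ cls x′
  ... | yes cls≡ = proj₁ (same-class⇒NEq x x′ cls≡)
  ... | no cls≢ = proj₁ (smaller-class⇒NSSub x x′ (≤∧≢⇒< cls≤ cls≢))

  last-class⇒universal : ∀ x → cls x ≡ fromℕ n → Universalˣ G x
  last-class⇒universal x clsx≡last y with neighbourʸ G noIso y
  ... | x′ , x′y = cls-≤⇒NSub x′ x (subst (cls x′ ≤ᶠ_) (sym clsx≡last) (≤fromℕ (cls x′))) y x′y

  first-class-minimal : ∀ x → NSub G (rep zero) x
  first-class-minimal x = cls-≤⇒NSub (rep zero) x (subst (_≤ᶠ cls x) (sym (cls-rep zero)) z≤n)

  x⁺ : Fin a
  x⁺ = rep (fromℕ n)

  x⁺-universal : Universalˣ G x⁺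
  x⁺-universal = last-class⇒universal x⁺ (cls-rep (fromℕ n))

  y⁺ : Fin b
  y⁺ = proj₁ (neighbourˣ G noIso (rep zero))

  y⁺-universal : Universalʸ G y⁺
  y⁺-universal x = first-class-minimal x y⁺ (proj₂ (neighbourˣ G noIso (rep zero)))

  γt≡2 : IsGammaT G 2
  γt≡2 = universal-pair⇒γt≡2 G x⁺-universal y⁺-universal

  ∃-private-neighbour : ∀ {i j} → i <ᶠ j → ∃ λ y → E (rep j) y ≡ true × E (rep i) y ≢ true
  ∃-private-neighbour {i} {j} i<j = ∃-witness-of-⊈ (E (rep j)) (E (rep i)) (proj₂
    (smaller-class⇒NSSub (rep i) (rep j) (subst₂ _<ᶠ_ (sym (cls-rep i)) (sym (cls-rep j)) i<j)))

chain₁⇒χtd≡2 : (G : BipGraph) → NoIsolated G → HasChainPartitionOfLength G 1 → IsChiTD G 2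
chain₁⇒χtd≡2 G noIso P = TDColorable⇒IsChiTD G
  (complete⇒TDColorable-2 G x⁺ y⁺ λ x → last-class⇒universal x (Fin1-unique _ _))
  (¬TDColorable-1 G (x⁺-universal y⁺))
  where open ChainPartition G noIso P

chain₂⇒χtd≡3 : (G : BipGraph) → NoIsolated G → HasChainPartitionOfLength G 2 → IsChiTD G 3
chain₂⇒χtd≡3 G noIso P =
  let _ , x₂y₂ , x₁≁y₂ = ∃-private-neighbour {# 0} {# 1} (s≤s z≤n)
  in TDColorable⇒IsChiTD G
       (minimal-or-universal⇒TDColorable-3 G (y⁺-universal (rep zero)) x⁺-universal
          first-class-minimal first-or-last)
       (¬TDColorable-2 G x₂y₂ x₁≁y₂)
  where
  open ChainPartition G noIso P
  first-or-last : ∀ x → NSub G x (rep zero) ⊎ Universalˣ G x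
  first-or-last x with cls x in clsx
  ... | zero = inj₁ (proj₁ (same-class⇒NEq x (rep zero) (trans clsx (sym (cls-rep zero)))))
  ... | suc zero = inj₂ (last-class⇒universal x clsx)

chain₃₊⇒χtd≡4 : ∀ {n} (G : BipGraph) → NoIsolated G → HasChainPartitionOfLength G (3 + n) →
                IsChiTD G 4
chain₃₊⇒χtd≡4 G noIso P =
  let _ , x₂y₂ , x₁≁y₂ = ∃-private-neighbour {# 0} {# 1} (s≤s z≤n)
      _ , _ , x₂≁y₃ = ∃-private-neighbour {# 1} {# 2} (s≤s (s≤s z≤n))
  in TDColorable⇒IsChiTD G
       (universal-pair⇒TDColorable-4 G x⁺-universal y⁺-universal)
       (¬TDColorable-3 G x₂y₂ x₁≁y₂ x₂≁y₃)
  where open ChainPartition G noIso P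

lemma3 : (G : BipGraph) → 1 ≤ BipGraph.a G → IsChainGraph G → NoIsolated G →
    (k : ℕ) → HasChainPartitionOfLength G k →
    IsGammaT G 2 ×
    (∃ λ m → IsChiTD G m × 2 ≤ m × m ≤ 4 × (2 ≤ k → 3 ≤ m) × (3 ≤ k → m ≡ 4))
lemma3 G 1≤a _ _ zero (cls , _) = ⊥-elim (¬Fin0 (cls (fromℕ< 1≤a)))
lemma3 G _ _ noIso 1 P =
  ChainPartition.γt≡2 G noIso P , 2 , chain₁⇒χtd≡2 G noIso P ,
  ≤-refl , s≤s (s≤s z≤n) , (λ { (s≤s ()) }) , (λ { (s≤s ()) })
lemma3 G _ _ noIso 2 P =
  ChainPartition.γt≡2 G noIso P , 3 , chain₂⇒χtd≡3 G noIso P ,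
  s≤s (s≤s z≤n) , s≤s (s≤s (s≤s z≤n)) , (λ _ → ≤-refl) , (λ { (s≤s (s≤s ())) })
lemma3 G _ _ noIso (suc (suc (suc _))) P =
  ChainPartition.γt≡2 G noIso P , 4 , chain₃₊⇒χtd≡4 G noIso P ,
  s≤s (s≤s z≤n) , ≤-refl , (λ _ → s≤s (s≤s (s≤s z≤n))) , (λ _ → refl)
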